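{- Let $H$ and $G$ be connected graphs with $v(H)<\frac{v(G)}{2}$. Then the number of vertices $v\in V(G)$ such that $G-v$ has a connected component isomorphic to $H$ is at most $\left\lfloor \frac{v(G)}{v(H)+1}\right\rfloor$.
   Context: All graphs are finite and simple; $v(X)$ denotes the number of vertices of $X$, and $G-v$ is the graph obtained by deleting $v$ and its incident edges. -}

module Defs where

open import Level using (0ℓ)
open import Data.Nat using (ℕ; zero; suc)
open import Data.Fin using (Fin; punchIn)
open import Data.Product using (Σ; _×_; ∃; ∃-syntax)
open import Data.Unit using (⊤)
open import Relation.Binary.PropositionalEquality using (_≡_)
open import Relation.Nullary using (¬_)
open import Function.Bundles using (_⇔_)
open import Function.Definitions using (Injective)

record Graph : Set₁ where
  field
    n      : ℕ
    Adj    : Fin n → Fin n → Set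
    sym    : ∀ {x y} → Adj x y → Adj y x
    irrefl : ∀ {x} → ¬ Adj x x

open Graph public

v : Graph → ℕ
v = Graph.n

deleteAux : (m : ℕ) (A : Fin m → Fin m → Set)
            (s : ∀ {x y} → A x y → A y x) (ir : ∀ {x} → ¬ A x x) →
            Fin m → Graph
deleteAux (suc m) A s ir u = record
  { n = m
  ; Adj = λ i j → A (punchIn u i) (punchIn u j)
  ; sym = s
  ; irrefl = ir
  }

_-_ : (G : Graph) → Fin (v G) → Graph
G - u = deleteAux (n G) (Adj G) (sym G) (irrefl G) u

data WalkIn (G : Graph) (P : Fin (v G) → Set) : Fin (v G) → Fin (v G) → Set where
  here : ∀ {x} → P x → WalkIn G P x x
  step : ∀ {x y z} → P x → Adj G x y → WalkIn G P y z → WalkIn G P x z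

Connected : Graph → Set
Connected G = Fin (v G) × (∀ x y → WalkIn G (λ _ → ⊤) x y)

IsComponent : (G : Graph) → (Fin (v G) → Set) → Set
IsComponent G C =
  (∃[ x ] C x) ×
  (∀ x y → C x → C y → WalkIn G C x y) ×
  (∀ x y → C x → Adj G x y → C y)

IsoToInduced : (H G : Graph) → (Fin (v G) → Set) → Set
IsoToInduced H G C =
  Σ (Fin (v H) → Fin (v G)) λ f →
    Injective _≡_ _≡_ f ×
    (∀ x → C x ⇔ (∃[ i ] f i ≡ x)) ×
    (∀ i j → Adj H i j ⇔ Adj G (f i) (f j))

HasComponentIso : (G H : Graph) → Set₁
HasComponentIso G H =
  Σ (Fin (v G) → Set) λ C → IsComponent G C × IsoToInduced H G C

-- For u ∈ S let C_u be a component of G − u isomorphic to H. The sets {u} ∪ C_u,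
-- each of size v(H) + 1, are pairwise disjoint, which gives the bound.
-- Since G is connected, u has a neighbour in C_u, and a connected set avoiding w
-- that meets C_w lies inside C_w. Hence u ∈ C_w and w ∈ C_u together would make
-- C_u ∪ C_w closed in G, i.e. all of G, contradicting 2 v(H) < v(G); u ∈ C_w alone
-- would put a neighbour of w, hence all of C_w ∪ {w}, inside C_u, which is too
-- small; and if neither root lies in the other component, a common vertex would
-- force C_u ⊆ C_w and so put the neighbour of u from C_u into C_w, whence u ∈ C_w.
{-# OPTIONS --safe #-}
module Submission where

open import Defs hiding (sym)
open import Data.Nat using (ℕ; suc; _*_; _+_; _≤_; _<_; _/_)
open import Data.Nat.Properties using (+-identityʳ; <⇒≱; 1+n≰n)
open import Data.Nat.DivMod using (m*n/n≡m; /-monoˡ-≤)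
open import Data.Fin using (Fin; zero; suc; punchIn; punchOut; _≟_; splitAt; _↑ˡ_; _↑ʳ_; remQuot)
open import Data.Fin.Properties using (any?; injective⇒≤; punchIn-injective; punchInᵢ≢i; punchIn-punchOut; splitAt-↑ˡ; splitAt-↑ʳ; *↔×)
open import Data.List using (List; length; lookup)
open import Data.List.Membership.Propositional.Properties using (∈-lookup)
open import Data.List.Relation.Unary.All as All using (All)
open import Data.List.Relation.Unary.AllPairs using (_∷_)
open import Data.List.Relation.Unary.Unique.Propositional using (Unique)
open import Data.Product using (∃; _,_; proj₁; proj₂; uncurry)
open import Data.Sum using (_⊎_; inj₁; inj₂; [_,_])
open import Data.Unit using (⊤)
open import Data.Empty using (⊥; ⊥-elim)
open import Relation.Nullary using (¬_; Dec; yes; no)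
open import Relation.Binary.PropositionalEquality using (_≡_; _≢_; refl; sym; trans; cong; subst)
open import Function using (_∘_; id)
open import Function.Bundles using (Equivalence; Injection)
open import Function.Properties.Inverse using (Inverse⇒Injection)
open import Function.Definitions using (Injective)

Image : ∀ {h N} → (Fin h → Fin N) → Fin N → Set
Image f z = ∃ λ i → f i ≡ z

Image? : ∀ {h N} (f : Fin h → Fin N) z → Dec (Image f z)
Image? f z = any? (λ i → f i ≟ z)

injection-into-image⇒≤ : ∀ {h k N} (f : Fin h → Fin N) (e : Fin k → Fin N) →
                         Injective _≡_ _≡_ e → (∀ a → Image f (e a)) → k ≤ h
injection-into-image⇒≤ f e e-injective e⊆f = injective⇒≤ {f = proj₁ ∘ e⊆f}
  (λ {a} {b} eq → e-injective (trans (sym (proj₂ (e⊆f a))) (trans (cong f eq) (proj₂ (e⊆f b)))))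

disjoint-family⇒*≤ : ∀ {m k N} (F : Fin m → Fin k → Fin N) →
                     (∀ i → Injective _≡_ _≡_ (F i)) →
                     (∀ {i j} a b → F i a ≡ F j b → i ≡ j) → m * k ≤ N
disjoint-family⇒*≤ {m} {k} F F-injective F-disjoint =
  injective⇒≤ {f = uncurry F ∘ remQuot k} (Injection.injective (Inverse⇒Injection *↔×) ∘ pair-injective)
  where
  pair-injective : Injective _≡_ _≡_ (uncurry F)
  pair-injective {i , a} {j , b} eq with F-disjoint a b eq
  ... | refl = cong (i ,_) (F-injective i eq)

lookup-injective : ∀ {A : Set} {xs : List A} → Unique xs → Injective _≡_ _≡_ (lookup xs)
lookup-injective (_ ∷ _) {zero} {zero} _ = refl
lookup-injective (x∉xs ∷ _) {zero} {suc j} eq = ⊥-elim (All.lookup x∉xs (∈-lookup j) eq)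
lookup-injective (x∉xs ∷ _) {suc i} {zero} eq = ⊥-elim (All.lookup x∉xs (∈-lookup i) (sym eq))
lookup-injective (_ ∷ unique) {suc i} {suc j} eq = cong suc (lookup-injective unique eq)

module _ {G : Graph} where

  walk-head : ∀ {P x y} → WalkIn G P x y → P x
  walk-head (here px) = px
  walk-head (step px _ _) = px

  transport-along : ∀ {P T : Fin (v G) → Set} {x y} →
                    (∀ {a b} → T a → Adj G a b → P b → T b) → WalkIn G P x y → T x → T y
  transport-along keep (here _) tx = tx
  transport-along keep (step _ x~y w) tx = transport-along keep w (keep tx x~y (walk-head w))

map-walk : ∀ {G K : Graph} {P Q} (φ : Fin (v G) → Fin (v K)) →
           (∀ {x y} → Adj G x y → Adj K (φ x) (φ y)) → (∀ {x} → P x → Q (φ x)) →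
           ∀ {x y} → WalkIn G P x y → WalkIn K Q (φ x) (φ y)
map-walk φ φ-adj φ-pred (here px) = here (φ-pred px)
map-walk φ φ-adj φ-pred (step px x~y w) = step (φ-pred px) (φ-adj x~y) (map-walk φ φ-adj φ-pred w)

-- A component of G − u of size h, seen inside G.
record DeletionComponent (G : Graph) (h : ℕ) (u : Fin (v G)) : Set where
  field
    embed           : Fin h → Fin (v G)
    embed-injective : Injective _≡_ _≡_ embed
    embed≢root      : ∀ i → embed i ≢ u
    connected       : ∀ i j → WalkIn G (Image embed) (embed i) (embed j)
    closed          : ∀ {x y} → Image embed x → Adj G x y → y ≢ u → Image embed y

  withRoot : Fin (suc h) → Fin (v G)
  withRoot zero = u
  withRoot (suc i) = embed i

  withRoot-injective : Injective _≡_ _≡_ withRoot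
  withRoot-injective {zero} {zero} _ = refl
  withRoot-injective {zero} {suc j} eq = ⊥-elim (embed≢root j (sym eq))
  withRoot-injective {suc i} {zero} eq = ⊥-elim (embed≢root i eq)
  withRoot-injective {suc i} {suc j} eq = cong suc (embed-injective eq)

open DeletionComponent

-- Stated for the eta-expansion of G, since G − u only computes once v(G) is a successor.
fromHasComponentIso : ∀ {H} m (A : Fin m → Fin m → Set) (s : ∀ {x y} → A x y → A y x) (ir : ∀ {x} → ¬ A x x)
                      (u : Fin m) → HasComponentIso (deleteAux m A s ir u) H →
                      DeletionComponent (record { n = m ; Adj = A ; sym = s ; irrefl = ir }) (v H) u
fromHasComponentIso (suc m) A s ir u (C , (_ , C-connected , C-closed) , f , f-injective , C⇔f , _) = record
  { embed = punchIn u ∘ f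
  ; embed-injective = f-injective ∘ punchIn-injective u _ _
  ; embed≢root = punchInᵢ≢i u ∘ f
  ; connected = λ i j → map-walk (punchIn u) id inImage (C-connected (f i) (f j) (inC i) (inC j))
  ; closed = closed′
  }
  where
  inC : ∀ i → C (f i)
  inC i = Equivalence.from (C⇔f (f i)) (i , refl)

  inImage : ∀ {x} → C x → Image (punchIn u ∘ f) (punchIn u x)
  inImage {x} cx with Equivalence.to (C⇔f x) cx
  ... | i , fi≡x = i , cong (punchIn u) fi≡x

  closed′ : ∀ {x y} → Image (punchIn u ∘ f) x → A x y → y ≢ u → Image (punchIn u ∘ f) y
  closed′ {y = y} (k , refl) x~y y≢u =
    subst (Image (punchIn u ∘ f)) y′↦y
      (inImage (C-closed (f k) (punchOut u≢y) (inC k) (subst (A _) (sym y′↦y) x~y)))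
    where
    u≢y : u ≢ y
    u≢y = y≢u ∘ sym
    y′↦y : punchIn u (punchOut u≢y) ≡ y
    y′↦y = punchIn-punchOut u≢y

absorbed : ∀ {G h u w} (du : DeletionComponent G h u) (dw : DeletionComponent G h w) →
           ¬ Image (embed du) w → ∀ {i} → Image (embed dw) (embed du i) →
           ∀ j → Image (embed dw) (embed du j)
absorbed {G} du dw w∉Cu {i} meet j = transport-along keep (connected du i j) meet
  where
  keep : ∀ {a b} → Image (embed dw) a → Adj G a b → Image (embed du) b → Image (embed dw) b
  keep ia a~b ib = closed dw ia a~b (λ b≡w → w∉Cu (subst (Image (embed du)) b≡w ib))

module _ {G : Graph} (walks : ∀ x y → WalkIn G (λ _ → ⊤) x y) {h : ℕ} (x₀ : Fin h) where

  root-not-isolated : ∀ {u} (d : DeletionComponent G h u) → ¬ (∀ i → ¬ Adj G (embed d i) u)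
  root-not-isolated {u} d isolated =
    uncurry (embed≢root d) (transport-along closed-in-G (walks (embed d x₀) u) (x₀ , refl))
    where
    closed-in-G : ∀ {a b} → Image (embed d) a → Adj G a b → ⊤ → Image (embed d) b
    closed-in-G (i , refl) a~b _ = closed d (i , refl) a~b (λ b≡u → isolated i (subst (Adj G _) b≡u a~b))

  root-in-other : ∀ {u w} (du : DeletionComponent G h u) (dw : DeletionComponent G h w) →
                  Image (embed dw) u → ¬ Image (embed du) w → ⊥
  root-in-other {u} {w} du dw u∈Cw w∉Cu = root-not-isolated du λ k k~u →
    1+n≰n (injection-into-image⇒≤ (embed dw) (withRoot du) (withRoot-injective du)
             λ { zero → u∈Cw ; (suc j) → absorbed du dw w∉Cu (k∈Cw k k~u) j })
    where
    k∈Cw : ∀ k → Adj G (embed du k) u → Image (embed dw) (embed du k)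
    k∈Cw k k~u = closed dw u∈Cw (Graph.sym G k~u) (λ k↦w → w∉Cu (k , k↦w))

  roots-outside-meet : ∀ {u w} (du : DeletionComponent G h u) (dw : DeletionComponent G h w) →
                       u ≢ w → ¬ Image (embed du) w → ¬ Image (embed dw) u →
                       ∀ {i} → Image (embed dw) (embed du i) → ⊥
  roots-outside-meet du dw u≢w w∉Cu u∉Cw meet =
    root-not-isolated du λ k k~u → u∉Cw (closed dw (absorbed du dw w∉Cu meet k) k~u u≢w)

  module _ (2h<N : 2 * h < v G) where

    roots-in-each-other : ∀ {u w} (du : DeletionComponent G h u) (dw : DeletionComponent G h w) →
                          Image (embed du) w → Image (embed dw) u → ⊥
    roots-in-each-other {u} {w} du dw w∈Cu u∈Cw =
      <⇒≱ 2h<N (subst (v G ≤_) (cong (h +_) (sym (+-identityʳ h)))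
        (injection-into-image⇒≤ ([ embed du , embed dw ] ∘ splitAt h) id id (inUnion ∘ covered)))
      where
      Union : Fin (v G) → Set
      Union z = Image (embed du) z ⊎ Image (embed dw) z

      union-closed : ∀ {a b} → Union a → Adj G a b → ⊤ → Union b
      union-closed {b = b} (inj₁ ia) a~b _ with b ≟ u
      ... | yes refl = inj₂ u∈Cw
      ... | no b≢u = inj₁ (closed du ia a~b b≢u)
      union-closed {b = b} (inj₂ ia) a~b _ with b ≟ w
      ... | yes refl = inj₁ w∈Cu
      ... | no b≢w = inj₂ (closed dw ia a~b b≢w)

      covered : ∀ z → Union z
      covered z = transport-along union-closed (walks u z) (inj₂ u∈Cw)

      inUnion : ∀ {z} → Union z → Image ([ embed du , embed dw ] ∘ splitAt h) z
      inUnion (inj₁ (i , eq)) = i ↑ˡ h , trans (cong [ embed du , embed dw ] (splitAt-↑ˡ h i h)) eq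
      inUnion (inj₂ (i , eq)) = h ↑ʳ i , trans (cong [ embed du , embed dw ] (splitAt-↑ʳ h h i)) eq

    root-outside : ∀ {u w} (du : DeletionComponent G h u) (dw : DeletionComponent G h w) →
                   ¬ Image (embed dw) u
    root-outside {w = w} du dw u∈Cw with Image? (embed du) w
    ... | yes w∈Cu = roots-in-each-other du dw w∈Cu u∈Cw
    ... | no w∉Cu = root-in-other du dw u∈Cw w∉Cu

    withRoot-disjoint : ∀ {u w} (du : DeletionComponent G h u) (dw : DeletionComponent G h w) →
                        u ≢ w → ∀ i j → withRoot du i ≢ withRoot dw j
    withRoot-disjoint du dw u≢w zero zero = u≢w
    withRoot-disjoint du dw u≢w zero (suc j) eq = root-outside du dw (j , sym eq)
    withRoot-disjoint du dw u≢w (suc i) zero eq = root-outside dw du (i , eq)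
    withRoot-disjoint du dw u≢w (suc i) (suc j) eq =
      roots-outside-meet du dw u≢w (root-outside dw du) (root-outside du dw) (j , sym eq)

lemma15 : (H G : Graph) → Connected H → Connected G → 2 * v H < v G →
    (S : List (Fin (v G))) → Unique S →
    All (λ u → HasComponentIso (G - u) H) S →
    length S ≤ v G / suc (v H)
lemma15 H G (x₀ , _) (_ , walks) 2h<N S S-unique components =
  subst (_≤ v G / suc (v H)) (m*n/n≡m (length S) (suc (v H))) (/-monoˡ-≤ (suc (v H)) size)
  where
  d : ∀ k → DeletionComponent G (v H) (lookup S k)
  d k = fromHasComponentIso {H} (n G) (Adj G) (Graph.sym G) (irrefl G) (lookup S k)
          (All.lookup components (∈-lookup k))

  same-root : ∀ {k l} a b → withRoot (d k) a ≡ withRoot (d l) b → k ≡ l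
  same-root {k} {l} a b eq with lookup S k ≟ lookup S l
  ... | yes root-eq = lookup-injective S-unique root-eq
  ... | no root-ne = ⊥-elim (withRoot-disjoint walks x₀ 2h<N (d k) (d l) root-ne a b eq)

  size : length S * suc (v H) ≤ v G
  size = disjoint-family⇒*≤ (withRoot ∘ d) (withRoot-injective ∘ d) same-root
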